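{- Let $A=\{\pi,\eta,\varphi\}$ be linearly ordered by $\pi<\eta<\varphi$. Then the induced order $\le_\eta$ on $A_\eta^*=\{\pi,\varphi\}^*$ coincides with the chronological order on $\{\pi,\varphi\}^*$.
   Context: All order relations are reflexive. For a set $X$, $X^*$ is the free monoid of finite words over $X$ (including the empty word); $|w|$ is the length and $w_i$ the $i$-th letter of a word $w$. For a poset $(A,\le)$ and $a\in A$, $A_a^*=(A\setminus\{a\})^*$; a word $w'\in A^*$ is an $a$-extension of $w\in A_a^*$ if $w'$ is obtained from $w$ by inserting finitely many (possibly zero) copies of $a$ at arbitrary positions. The induced order on $A_a^*$: $v\le_a w$ iff there exist $a$-extensions $v'$ of $v$ and $w'$ of $w$ with $|v'|=|w'|=n$ and $v'_i\le w'_i$ in $A$ for all $i=1,\dots,n$. The chronological order on $\{\pi,\varphi\}^*$: $v\le w$ iff $w$ can be obtained from $v$ by erasing some (possibly zero) occurrences of the letter $\pi$ and/or inserting some (possibly zero) letters $\varphi$. -}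

module Defs where

open import Data.List using (List; []; _∷_; map)
open import Data.List.Relation.Binary.Pointwise using (Pointwise)
open import Data.Product using (∃; ∃-syntax; _×_)
open import Level using (Level)
open import Relation.Binary using (Rel; IsPartialOrder)
open import Relation.Binary.PropositionalEquality using (_≡_)

data Ext {ℓ} {A : Set ℓ} (a : A) : List A → List A → Set ℓ where
  ext-[]  : Ext a [] []
  ext-ins : ∀ {w w'} → Ext a w w' → Ext a w (a ∷ w')
  ext-keep : ∀ {x w w'} → Ext a w w' → Ext a (x ∷ w) (x ∷ w')

-- Induced order ≤_a on A_a^* (words not containing a; the restriction
-- to such words is imposed where it is used): v ≤_a w iff there are
-- a-extensions v', w' of equal length with v'_i ≤ w'_i letterwise
-- (Pointwise forces equal length).
InducedLe : ∀ {ℓ r} {A : Set ℓ} (_≤_ : Rel A r) (a : A) → List A → List A → Set (ℓ Level.⊔ r)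
InducedLe _≤_ a v w =
  ∃[ v' ] ∃[ w' ] (Ext a v v' × Ext a w w' × Pointwise _≤_ v' w')

data Letter : Set where
  π η φ : Letter

data _≤L_ : Letter → Letter → Set where
  π≤π : π ≤L π
  π≤η : π ≤L η
  π≤φ : π ≤L φ
  η≤η : η ≤L η
  η≤φ : η ≤L φ
  φ≤φ : φ ≤L φ

data PF : Set where
  πₚ φₚ : PF

incl : PF → Letter
incl πₚ = π
incl φₚ = φ

inclW : List PF → List Letter
inclW = map incl

data Chrono : List PF → List PF → Set where
  ch-[]    : Chrono [] []
  ch-eraseπ : ∀ {v w} → Chrono v w → Chrono (πₚ ∷ v) w
  ch-insφ  : ∀ {v w} → Chrono v w → Chrono v (φₚ ∷ w)
  ch-keep  : ∀ {x v w} → Chrono v w → Chrono (x ∷ v) (x ∷ w)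

-- Align the two η-extensions letterwise. Every admissible column x ≤ y is one of
-- the moves of the chronological order: (π,η) erases a π, (η,φ) inserts a φ,
-- (π,φ) does both, (π,π) and (φ,φ) keep a letter, and (η,η) is idle. Erasing
-- the η's from an aligned pair therefore yields a chronological pair, and
-- conversely each chronological move is realised by one such column.
module Submission where

open import Defs
open import Data.List using (List; []; _∷_)
open import Data.List.Relation.Binary.Pointwise using (Pointwise; []; _∷_)
open import Data.Product using (_×_; _,_)
open import Relation.Binary using (Rel)
open import Relation.Binary.PropositionalEquality using (_≡_; refl; cong; subst₂)

module _ {ℓ r} {A : Set ℓ} {_≤_ : Rel A r} {a : A} where

  InducedLe-[] : InducedLe _≤_ a [] []
  InducedLe-[] = [] , [] , ext-[] , ext-[] , []

  InducedLe-∷ : ∀ {x y v w} → x ≤ y → InducedLe _≤_ a v w →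
                InducedLe _≤_ a (x ∷ v) (y ∷ w)
  InducedLe-∷ x≤y (v' , w' , ev , ew , v'≤w') =
    _ , _ , ext-keep ev , ext-keep ew , x≤y ∷ v'≤w'

  InducedLe-∷ˡ : ∀ {x v w} → x ≤ a → InducedLe _≤_ a v w → InducedLe _≤_ a (x ∷ v) w
  InducedLe-∷ˡ x≤a (v' , w' , ev , ew , v'≤w') =
    _ , _ , ext-keep ev , ext-ins ew , x≤a ∷ v'≤w'

  InducedLe-∷ʳ : ∀ {y v w} → a ≤ y → InducedLe _≤_ a v w → InducedLe _≤_ a v (y ∷ w)
  InducedLe-∷ʳ a≤y (v' , w' , ev , ew , v'≤w') =
    _ , _ , ext-ins ev , ext-keep ew , a≤y ∷ v'≤w'

≤L-refl : ∀ x → x ≤L x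
≤L-refl π = π≤π
≤L-refl η = η≤η
≤L-refl φ = φ≤φ

deleteη : List Letter → List PF
deleteη []      = []
deleteη (π ∷ w) = πₚ ∷ deleteη w
deleteη (η ∷ w) = deleteη w
deleteη (φ ∷ w) = φₚ ∷ deleteη w

deleteη-inclW : ∀ v → deleteη (inclW v) ≡ v
deleteη-inclW []       = refl
deleteη-inclW (πₚ ∷ v) = cong (πₚ ∷_) (deleteη-inclW v)
deleteη-inclW (φₚ ∷ v) = cong (φₚ ∷_) (deleteη-inclW v)

deleteη-Ext : ∀ {u u'} → Ext η u u' → deleteη u' ≡ deleteη u
deleteη-Ext ext-[]           = refl
deleteη-Ext (ext-ins e)      = deleteη-Ext e
deleteη-Ext (ext-keep {π} e) = cong (πₚ ∷_) (deleteη-Ext e)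
deleteη-Ext (ext-keep {η} e) = deleteη-Ext e
deleteη-Ext (ext-keep {φ} e) = cong (φₚ ∷_) (deleteη-Ext e)

Pointwise⇒Chrono-deleteη : ∀ {v' w'} → Pointwise _≤L_ v' w' →
                           Chrono (deleteη v') (deleteη w')
Pointwise⇒Chrono-deleteη []            = ch-[]
Pointwise⇒Chrono-deleteη (π≤π ∷ v'≤w') = ch-keep (Pointwise⇒Chrono-deleteη v'≤w')
Pointwise⇒Chrono-deleteη (π≤η ∷ v'≤w') = ch-eraseπ (Pointwise⇒Chrono-deleteη v'≤w')
Pointwise⇒Chrono-deleteη (π≤φ ∷ v'≤w') = ch-eraseπ (ch-insφ (Pointwise⇒Chrono-deleteη v'≤w'))
Pointwise⇒Chrono-deleteη (η≤η ∷ v'≤w') = Pointwise⇒Chrono-deleteη v'≤w'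
Pointwise⇒Chrono-deleteη (η≤φ ∷ v'≤w') = ch-insφ (Pointwise⇒Chrono-deleteη v'≤w')
Pointwise⇒Chrono-deleteη (φ≤φ ∷ v'≤w') = ch-keep (Pointwise⇒Chrono-deleteη v'≤w')

InducedLe⇒Chrono : ∀ v w → InducedLe _≤L_ η (inclW v) (inclW w) → Chrono v w
InducedLe⇒Chrono v w (v' , w' , ev , ew , v'≤w') =
  subst₂ Chrono (recover v ev) (recover w ew) (Pointwise⇒Chrono-deleteη v'≤w')
  where
  recover : ∀ u {u'} → Ext η (inclW u) u' → deleteη u' ≡ u
  recover u e rewrite deleteη-Ext e = deleteη-inclW u

Chrono⇒InducedLe : ∀ {v w} → Chrono v w → InducedLe _≤L_ η (inclW v) (inclW w)
Chrono⇒InducedLe ch-[]           = InducedLe-[]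
Chrono⇒InducedLe (ch-eraseπ c)   = InducedLe-∷ˡ π≤η (Chrono⇒InducedLe c)
Chrono⇒InducedLe (ch-insφ c)     = InducedLe-∷ʳ η≤φ (Chrono⇒InducedLe c)
Chrono⇒InducedLe (ch-keep {x} c) = InducedLe-∷ (≤L-refl (incl x)) (Chrono⇒InducedLe c)

mainTheorem4 : (v w : List PF) →
    (InducedLe _≤L_ η (inclW v) (inclW w) → Chrono v w) ×
    (Chrono v w → InducedLe _≤L_ η (inclW v) (inclW w))
mainTheorem4 v w = InducedLe⇒Chrono v w , Chrono⇒InducedLe
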